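{- Let $\mathcal G=(V,\mathcal E)$ be a temporal digraph with $n=|V|$ such that its footprint $\mathcal G_\downarrow$ has $cc$ (weakly) connected components, and let $p=|\mathcal E|+cc-n$. Then there exists a set $S\subseteq V$ with $|S|\leq p$ that is a directed feedback vertex set of $\mathrm{Reach}(\mathcal G)$.
   Context: A temporal digraph is a pair $\mathcal G=(V,\mathcal E)$ where $\mathcal E$ is a finite set of (distinct) temporal arcs $((u,v),t)$ with $u\neq v\in V$ and $t$ a positive integer. A journey from $u_0$ to $u_k$ is a sequence $(u_0,u_1,t_0),\dots,(u_{k-1},u_k,t_{k-1})$ with each $((u_i,u_{i+1}),t_i)\in\mathcal E$ and $t_0<\dots<t_{k-1}$. The footprint $\mathcal G_\downarrow$ is the static digraph on $V$ with arc set $\{(u,v):((u,v),t)\in\mathcal E\text{ for some }t\}$; its connected components are those of its underlying undirected graph. $\mathrm{Reach}(\mathcal G)$ is the digraph on $V$ with an arc $(u,v)$ iff there is a journey from $u$ to $v$ in $\mathcal G$. A directed feedback vertex set of a digraph is a vertex set meeting every circuit (directed cycle). -}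

module Defs where

open import Data.Nat using (ℕ; _<_; _≤_; _+_)
open import Data.Fin using (Fin)
open import Data.Product using (_×_; _,_; ∃; ∃-syntax; Σ-syntax)
open import Data.Sum using (_⊎_)
open import Data.List using (List; []; _∷_; length)
open import Data.List.Membership.Propositional using (_∈_)
open import Data.List.Relation.Unary.All using (All)
open import Data.List.Relation.Unary.Unique.Propositional using (Unique)
open import Data.Fin.Subset using (Subset; ∣_∣) renaming (_∈_ to _∈ₛ_)
open import Relation.Binary.PropositionalEquality using (_≡_)
open import Relation.Binary.Construct.Closure.ReflexiveTransitive using (Star)
open import Relation.Nullary using (¬_)
open import Function.Bundles using (_⇔_)

TArc : ℕ → Set
TArc n = (Fin n × Fin n) × ℕ

WfArc : ∀ {n} → TArc n → Set
WfArc ((u , v) , t) = (¬ u ≡ v) × (1 ≤ t)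

record TemporalDigraph (n : ℕ) : Set where
  field
    arcs     : List (TArc n)
    distinct : Unique arcs
    wf       : All WfArc arcs
open TemporalDigraph public

numArcs : ∀ {n} → TemporalDigraph n → ℕ
numArcs G = length (arcs G)

-- Jny G u w t : a journey from u to w whose first arc has time t
-- (nonempty sequence of arcs with strictly increasing times).
data Jny {n} (G : TemporalDigraph n) : Fin n → Fin n → ℕ → Set where
  single : ∀ {u v t} → ((u , v) , t) ∈ arcs G → Jny G u v t
  cons   : ∀ {u v w t t'} → ((u , v) , t) ∈ arcs G → t < t' → Jny G v w t' → Jny G u w t

Journey : ∀ {n} → TemporalDigraph n → Fin n → Fin n → Set
Journey G u w = ∃[ t ] Jny G u w t

Reach : ∀ {n} → TemporalDigraph n → Fin n → Fin n → Set
Reach G u v = (¬ u ≡ v) × Journey G u v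

Footprint : ∀ {n} → TemporalDigraph n → Fin n → Fin n → Set
Footprint G u v = ∃[ t ] ((u , v) , t) ∈ arcs G

UAdj : ∀ {n} → TemporalDigraph n → Fin n → Fin n → Set
UAdj G u v = Footprint G u v ⊎ Footprint G v u

Connected : ∀ {n} → TemporalDigraph n → Fin n → Fin n → Set
Connected G = Star (UAdj G)

-- The footprint has exactly cc connected components: there is a surjective
-- labelling of vertices by Fin cc whose fibres are exactly the components.
HasComponents : ∀ {n} → TemporalDigraph n → ℕ → Set
HasComponents {n} G cc =
  Σ[ f ∈ (Fin n → Fin cc) ] ((∀ (c : Fin cc) → ∃[ v ] f v ≡ c)
         × (∀ (u v : Fin n) → (f u ≡ f v) ⇔ Connected G u v))

Chain : ∀ {A : Set} → (A → A → Set) → A → List A → A → Set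
Chain R x []       y = R x y
Chain R x (w ∷ ws) y = R x w × Chain R w ws y

Circuit : ∀ {A : Set} → (A → A → Set) → A → List A → Set
Circuit R v vs = Unique (v ∷ vs) × Chain R v vs v

IsDFVS : ∀ {n} → (Fin n → Fin n → Set) → Subset n → Set
IsDFVS {n} R S = ∀ (v : Fin n) (vs : List (Fin n)) → Circuit R v vs →
  ∃[ x ] (x ∈ (v ∷ vs) × x ∈ₛ S)

{-# OPTIONS --safe #-}
-- Insert the temporal arcs in order of increasing time, maintaining a labelling
-- of the vertices by k classes that is constant along the arcs inserted so far,
-- and a feedback vertex set S of the reachability digraph with
-- |S| + n ≤ (arcs inserted) + k.  The newest arc (u , v) can only be the last
-- arc of a journey.  If u and v share a class, every new circuit passes through
-- v, which is added to S.  Otherwise the two classes are merged, so k drops by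
-- one: a new journey enters the class of v from outside and no journey leaves
-- that class, so no new circuit appears.  In the end the classes are unions of
-- footprint components, hence k ≤ cc.
module Submission where

open import Defs
open import Data.Nat using (ℕ; zero; suc; _<_; _≤_; _+_; _≤?_; z≤n; s≤s)
open import Data.Nat.Properties
  using (≤-refl; ≤-reflexive; ≤-trans; <⇒≱; ≰⇒>; <⇒≤; n≤1+n; +-monoˡ-≤; +-monoʳ-≤; +-suc; +-comm; suc-injective; module ≤-Reasoning)
open import Data.Product using (_×_; _,_; proj₁; proj₂; map₁; ∃-syntax; Σ-syntax)
open import Data.Sum using (_⊎_; inj₁; inj₂; [_,_]′; map₂)
open import Data.Empty using (⊥-elim)
open import Data.Fin using (Fin; punchIn; punchOut)
open import Data.Fin.Properties using (¬Fin0; punchOut-cong; punchOut-punchIn; punchInᵢ≢i; injective⇒≤; _≟_)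
open import Data.Fin.Subset using (Subset; ∣_∣; _∪_; ⁅_⁆; ⊥; inside; outside)
open import Data.Fin.Subset.Properties using (∣⊥∣≡0; ∣⁅x⁆∣≡1; x∈p∪q⁺; x∈⁅x⁆)
open import Data.Vec using ([]; _∷_)
open import Data.List using (List; []; _∷_; length)
open import Data.List.Membership.Propositional using (_∈_)
open import Data.List.Relation.Binary.Subset.Propositional using (_⊆_)
open import Data.List.Relation.Unary.Any using (here; there)
open import Data.List.Relation.Unary.All as All using (All; []; _∷_)
open import Data.List.Relation.Binary.Permutation.Propositional as ↭ using (_↭_; prep; swap)
open import Data.List.Relation.Binary.Permutation.Propositional.Properties using (∈-resp-↭; ↭-length)
open import Relation.Binary.PropositionalEquality using (_≡_; _≢_; refl; sym; trans; cong; subst)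
import Relation.Binary.Construct.Closure.ReflexiveTransitive as Star
open import Relation.Nullary using (¬_; yes; no)
open import Function using (id; _∘_; _on_)
open import Function.Bundles using (Equivalence)

∣p∪q∣≤∣p∣+∣q∣ : ∀ {m} (p q : Subset m) → ∣ p ∪ q ∣ ≤ ∣ p ∣ + ∣ q ∣
∣p∪q∣≤∣p∣+∣q∣ []            []            = z≤n
∣p∪q∣≤∣p∣+∣q∣ (inside ∷ p)  (inside ∷ q)  = s≤s (≤-trans (∣p∪q∣≤∣p∣+∣q∣ p q) (+-monoʳ-≤ ∣ p ∣ (n≤1+n ∣ q ∣)))
∣p∪q∣≤∣p∣+∣q∣ (inside ∷ p)  (outside ∷ q) = s≤s (∣p∪q∣≤∣p∣+∣q∣ p q)
∣p∪q∣≤∣p∣+∣q∣ (outside ∷ p) (inside ∷ q)  = ≤-trans (s≤s (∣p∪q∣≤∣p∣+∣q∣ p q)) (≤-reflexive (sym (+-suc ∣ p ∣ ∣ q ∣)))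
∣p∪q∣≤∣p∣+∣q∣ (outside ∷ p) (outside ∷ q) = ∣p∪q∣≤∣p∣+∣q∣ p q

∣p∪⁅x⁆∣≤1+∣p∣ : ∀ {m} (p : Subset m) (x : Fin m) → ∣ p ∪ ⁅ x ⁆ ∣ ≤ suc ∣ p ∣
∣p∪⁅x⁆∣≤1+∣p∣ p x = begin
  ∣ p ∪ ⁅ x ⁆ ∣     ≤⟨ ∣p∪q∣≤∣p∣+∣q∣ p ⁅ x ⁆ ⟩
  ∣ p ∣ + ∣ ⁅ x ⁆ ∣ ≡⟨ cong (∣ p ∣ +_) (∣⁅x⁆∣≡1 x) ⟩
  ∣ p ∣ + 1         ≡⟨ +-comm ∣ p ∣ 1 ⟩
  suc ∣ p ∣         ∎
  where open ≤-Reasoning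

collapse : ∀ {k} {i j : Fin (suc k)} → i ≢ j → Fin (suc k) → Fin k
collapse {i = i} i≢j c with i ≟ c
... | yes _   = punchOut i≢j
... | no i≢c = punchOut i≢c

collapse-identifies : ∀ {k} {i j : Fin (suc k)} (i≢j : i ≢ j) → collapse i≢j i ≡ collapse i≢j j
collapse-identifies {i = i} {j} i≢j with i ≟ i | i ≟ j
... | no i≢i | _       = ⊥-elim (i≢i refl)
... | yes _  | yes i≡j = ⊥-elim (i≢j i≡j)
... | yes _  | no _    = punchOut-cong i refl

collapse-onto : ∀ {k} {i j : Fin (suc k)} (i≢j : i ≢ j) (c : Fin k) → ∃[ d ] collapse i≢j d ≡ c
collapse-onto {i = i} i≢j c = punchIn i c , collapse-punchIn
  where
  collapse-punchIn : collapse i≢j (punchIn i c) ≡ c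
  collapse-punchIn with i ≟ punchIn i c
  ... | yes i≡ = ⊥-elim (punchInᵢ≢i i c (sym i≡))
  ... | no _   = trans (punchOut-cong i refl) (punchOut-punchIn i)

surjective-coarsening⇒≤ : ∀ {A : Set} {k m} (f : A → Fin m) (g : A → Fin k) →
  (∀ c → ∃[ x ] g x ≡ c) → (∀ x y → f x ≡ f y → g x ≡ g y) → k ≤ m
surjective-coarsening⇒≤ {k = k} {m} f g g-onto f≡⇒g≡ = injective⇒≤ section-injective
  where
  section : Fin k → Fin m
  section c = f (proj₁ (g-onto c))
  section-injective : ∀ {c d} → section c ≡ section d → c ≡ d
  section-injective {c} {d} eq =
    trans (sym (proj₂ (g-onto c))) (trans (f≡⇒g≡ _ _ eq) (proj₂ (g-onto d)))

module _ {A : Set} where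

  Chain-map : ∀ {R R' : A → A → Set} → (∀ {a b} → R a b → R' a b) →
              ∀ {x} ws {y} → Chain R x ws y → Chain R' x ws y
  Chain-map f []       r       = f r
  Chain-map f (w ∷ ws) (r , c) = f r , Chain-map f ws c

  module _ {R R' : A → A → Set} {x : A} (R'⊆R∪→x : ∀ {a b} → R' a b → R a b ⊎ b ≡ x) where

    Chain-old-or-visits : ∀ {y} ws {z} → Chain R' y ws z → Chain R y ws z ⊎ (x ∈ ws ⊎ z ≡ x)
    Chain-old-or-visits [] r with R'⊆R∪→x r
    ... | inj₁ r'  = inj₁ r'
    ... | inj₂ z≡x = inj₂ (inj₂ z≡x)
    Chain-old-or-visits (w ∷ ws) (r , c) with R'⊆R∪→x r | Chain-old-or-visits ws c
    ... | inj₂ w≡x | _                 = inj₂ (inj₁ (here (sym w≡x)))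
    ... | inj₁ r'  | inj₁ c'           = inj₁ (r' , c')
    ... | inj₁ _   | inj₂ (inj₁ x∈ws) = inj₂ (inj₁ (there x∈ws))
    ... | inj₁ _   | inj₂ (inj₂ z≡x)  = inj₂ (inj₂ z≡x)

    closedChain-old-or-visits : ∀ {v} vs → Chain R' v vs v → Chain R v vs v ⊎ x ∈ v ∷ vs
    closedChain-old-or-visits vs c with Chain-old-or-visits vs c
    ... | inj₁ c'           = inj₁ c'
    ... | inj₂ (inj₁ x∈vs) = inj₂ (there x∈vs)
    ... | inj₂ (inj₂ v≡x)  = inj₂ (here (sym v≡x))

  -- A chain inside P only takes old steps and stays in P, while a new step
  -- enters P; hence a closed chain takes no new step.
  module _ {R R' : A → A → Set} (P : A → Set)
           (R'⊆R∪→P : ∀ {a b} → R' a b → R a b ⊎ (¬ P a × P b))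
           (R-keeps-P : ∀ {a b} → R a b → P a → P b) where

    old-step-from-P : ∀ {a b} → P a → R' a b → R a b
    old-step-from-P pa r = [ id , (λ (¬pa , _) → ⊥-elim (¬pa pa)) ]′ (R'⊆R∪→P r)

    Chain-from-P : ∀ {y} ws {z} → P y → Chain R' y ws z → Chain R y ws z × P z
    Chain-from-P     []       py r       = old-step-from-P py r , R-keeps-P (old-step-from-P py r) py
    Chain-from-P {y} (w ∷ ws) py (r , c) = map₁ (r' ,_) (Chain-from-P ws (R-keeps-P r' py) c)
      where
      r' : R y w
      r' = old-step-from-P py r

    Chain-old-or-ends-in-P : ∀ {y} ws {z} → Chain R' y ws z → Chain R y ws z ⊎ P z
    Chain-old-or-ends-in-P [] r with R'⊆R∪→P r
    ... | inj₁ r'       = inj₁ r'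
    ... | inj₂ (_ , pz) = inj₂ pz
    Chain-old-or-ends-in-P (w ∷ ws) (r , c) with R'⊆R∪→P r
    ... | inj₂ (_ , pw) = inj₂ (proj₂ (Chain-from-P ws pw c))
    ... | inj₁ r' with Chain-old-or-ends-in-P ws c
    ...   | inj₁ c' = inj₁ (r' , c')
    ...   | inj₂ pz = inj₂ pz

    closedChain-old : ∀ {v} vs → Chain R' v vs v → Chain R v vs v
    closedChain-old vs c =
      [ id , (λ pv → proj₁ (Chain-from-P vs pv c)) ]′ (Chain-old-or-ends-in-P vs c)

  Chain-head : ∀ {R : A → A → Set} {x} ws {y} → Chain R x ws y → ∃[ z ] R x z
  Chain-head []       r       = _ , r
  Chain-head (w ∷ ws) (r , _) = w , r

module _ {n : ℕ} {R R' : Fin n → Fin n → Set} {S : Subset n} where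

  isDFVS-transfer : (∀ {v} vs → Chain R' v vs v → Chain R v vs v) → IsDFVS R S → IsDFVS R' S
  isDFVS-transfer old S-isDFVS v vs (distinct , c) = S-isDFVS v vs (distinct , old vs c)

  isDFVS-transfer-∪⁅⁆ : ∀ {x} → (∀ {v} vs → Chain R' v vs v → Chain R v vs v ⊎ x ∈ v ∷ vs) →
                        IsDFVS R S → IsDFVS R' (S ∪ ⁅ x ⁆)
  isDFVS-transfer-∪⁅⁆ {x} old-or-visits S-isDFVS v vs (distinct , c) with old-or-visits vs c
  ... | inj₂ x∈ = x , x∈ , x∈p∪q⁺ (inj₂ (x∈⁅x⁆ x))
  ... | inj₁ c' with S-isDFVS v vs (distinct , c')
  ...   | y , y∈ , y∈S = y , y∈ , x∈p∪q⁺ (inj₁ y∈S)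

module _ {n : ℕ} where

  time : TArc n → ℕ
  time = proj₂

  NoLaterThan : ℕ → List (TArc n) → Set
  NoLaterThan t = All (λ a → time a ≤ t)

  data JourneyIn (L : List (TArc n)) : Fin n → Fin n → ℕ → Set where
    single : ∀ {u v t} → ((u , v) , t) ∈ L → JourneyIn L u v t
    cons   : ∀ {u v w t t'} → ((u , v) , t) ∈ L → t < t' → JourneyIn L v w t' → JourneyIn L u w t

  ReachIn : List (TArc n) → Fin n → Fin n → Set
  ReachIn L u v = (¬ u ≡ v) × ∃[ t ] JourneyIn L u v t

  Jny⇒JourneyIn : ∀ {G : TemporalDigraph n} {u v t} → Jny G u v t → JourneyIn (arcs G) u v t
  Jny⇒JourneyIn (single a∈)    = single a∈
  Jny⇒JourneyIn (cons a∈ lt j) = cons a∈ lt (Jny⇒JourneyIn j)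

  Reach⇒ReachIn : ∀ {G : TemporalDigraph n} {u v} → Reach G u v → ReachIn (arcs G) u v
  Reach⇒ReachIn (u≢v , t , j) = u≢v , t , Jny⇒JourneyIn j

  JourneyIn-mono : ∀ {L₁ L₂} → L₁ ⊆ L₂ → ∀ {u v t} → JourneyIn L₁ u v t → JourneyIn L₂ u v t
  JourneyIn-mono L₁⊆L₂ (single a∈)    = single (L₁⊆L₂ a∈)
  JourneyIn-mono L₁⊆L₂ (cons a∈ lt j) = cons (L₁⊆L₂ a∈) lt (JourneyIn-mono L₁⊆L₂ j)

  ReachIn-mono : ∀ {L₁ L₂} → L₁ ⊆ L₂ → ∀ {u v} → ReachIn L₁ u v → ReachIn L₂ u v
  ReachIn-mono L₁⊆L₂ (u≢v , t , j) = u≢v , t , JourneyIn-mono L₁⊆L₂ j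

  ¬ReachIn-[] : ∀ {u v} → ¬ ReachIn [] u v
  ¬ReachIn-[] (_ , _ , single ())
  ¬ReachIn-[] (_ , _ , cons () _ _)

  JourneyIn-start≤ : ∀ {L T u v t} → NoLaterThan T L → JourneyIn L u v t → t ≤ T
  JourneyIn-start≤ L≤T (single a∈)   = All.lookup L≤T a∈
  JourneyIn-start≤ L≤T (cons a∈ _ _) = All.lookup L≤T a∈

  ConstantAlong : ∀ {k} → List (TArc n) → (Fin n → Fin k) → Set
  ConstantAlong L g = ∀ {x y t} → ((x , y) , t) ∈ L → g x ≡ g y

  JourneyIn-label : ∀ {k L} {g : Fin n → Fin k} → ConstantAlong L g →
                    ∀ {a b s} → JourneyIn L a b s → g a ≡ g b
  JourneyIn-label g-constant (single a∈)   = g-constant a∈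
  JourneyIn-label g-constant (cons a∈ _ j) = trans (g-constant a∈) (JourneyIn-label g-constant j)

  Connected-label : ∀ {k} {G : TemporalDigraph n} {g : Fin n → Fin k} → ConstantAlong (arcs G) g →
                    ∀ {a b} → Connected G a b → g a ≡ g b
  Connected-label {G = G} {g} g-constant = Star.fold (_≡_ on g) (λ adj eq → trans (adjacent-label adj) eq) refl
    where
    adjacent-label : ∀ {a b} → UAdj G a b → g a ≡ g b
    adjacent-label (inj₁ (_ , a∈)) = g-constant a∈
    adjacent-label (inj₂ (_ , a∈)) = sym (g-constant a∈)

  module _ {u v : Fin n} {t : ℕ} {L : List (TArc n)} (L≤t : NoLaterThan t L)
           {k} {g : Fin n → Fin k} (g-constant : ConstantAlong L g) where

    -- A journey has increasing times, so the latest arc can only be its last arc.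
    JourneyIn-∷-latest : ∀ {a b s} → JourneyIn (((u , v) , t) ∷ L) a b s →
                         JourneyIn L a b s ⊎ (g a ≡ g u × b ≡ v)
    JourneyIn-∷-latest (single (here refl))    = inj₂ (refl , refl)
    JourneyIn-∷-latest (single (there a∈))     = inj₁ (single a∈)
    JourneyIn-∷-latest (cons (here refl) lt j) = ⊥-elim (<⇒≱ lt (JourneyIn-start≤ (≤-refl ∷ L≤t) j))
    JourneyIn-∷-latest (cons (there a∈) lt j) with JourneyIn-∷-latest j
    ... | inj₁ j'           = inj₁ (cons a∈ lt j')
    ... | inj₂ (gx≡gu , b≡v) = inj₂ (trans (g-constant a∈) gx≡gu , b≡v)

    ReachIn-∷-latest : ∀ {a b} → ReachIn (((u , v) , t) ∷ L) a b → ReachIn L a b ⊎ (g a ≡ g u × b ≡ v)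
    ReachIn-∷-latest (a≢b , s , j) with JourneyIn-∷-latest j
    ... | inj₁ j' = inj₁ (a≢b , s , j')
    ... | inj₂ q  = inj₂ q

  extract-latest : (x : TArc n) (xs : List (TArc n)) →
    Σ[ e ∈ TArc n ] Σ[ L ∈ List (TArc n) ] ((x ∷ xs) ↭ (e ∷ L)) × NoLaterThan (time e) L
  extract-latest x [] = x , [] , ↭.refl , []
  extract-latest x (y ∷ ys) with extract-latest y ys
  ... | e , L , p , L≤e with time x ≤? time e
  ... | yes x≤e = e , x ∷ L , ↭.trans (prep x p) (swap x e ↭.refl) , x≤e ∷ L≤e
  ... | no x≰e = x , e ∷ L , prep x p , e≤x ∷ All.map (λ a≤e → ≤-trans a≤e e≤x) L≤e
    where
    e≤x : time e ≤ time x
    e≤x = <⇒≤ (≰⇒> x≰e)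

  latest-arc-induction : (P : List (TArc n) → Set) → (∀ {L₁ L₂} → L₁ ↭ L₂ → P L₂ → P L₁) → P [] →
    (∀ {e L} → NoLaterThan (time e) L → P L → P (e ∷ L)) → ∀ L → P L
  latest-arc-induction P P-resp-↭ P[] P∷ L = go (length L) L refl
    where
    go : ∀ m L → length L ≡ m → P L
    go _       []       _   = P[]
    go (suc m) (x ∷ xs) len with extract-latest x xs
    ... | e , L , p , L≤e = P-resp-↭ p (P∷ L≤e (go m L (suc-injective (trans (sym (↭-length p)) len))))

  record SmallDFVS (L : List (TArc n)) (k : ℕ) : Set where
    field
      label          : Fin n → Fin k
      label-onto     : ∀ c → ∃[ x ] label x ≡ c
      label-constant : ConstantAlong L label
      S              : Subset n
      S-small        : ∣ S ∣ + n ≤ length L + k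
      S-isDFVS       : IsDFVS (ReachIn L) S
  open SmallDFVS

  smallDFVS-[] : SmallDFVS [] n
  smallDFVS-[] = record
    { label = id ; label-onto = λ c → c , refl ; label-constant = λ ()
    ; S = ⊥ ; S-small = ≤-reflexive (cong (_+ n) (∣⊥∣≡0 n))
    ; S-isDFVS = λ v vs (_ , c) → ⊥-elim (¬ReachIn-[] (proj₂ (Chain-head vs c))) }

  smallDFVS-↭ : ∀ {L₁ L₂ k} → L₁ ↭ L₂ → SmallDFVS L₂ k → SmallDFVS L₁ k
  smallDFVS-↭ {k = k} p r = record
    { label = label r ; label-onto = label-onto r
    ; label-constant = λ a∈ → label-constant r (∈-resp-↭ p a∈)
    ; S = S r ; S-small = subst (λ m → ∣ S r ∣ + n ≤ m + k) (sym (↭-length p)) (S-small r)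
    ; S-isDFVS = isDFVS-transfer (λ vs → Chain-map (ReachIn-mono (∈-resp-↭ p)) vs) (S-isDFVS r) }

  module _ {u v : Fin n} {t : ℕ} {L : List (TArc n)} (L≤t : NoLaterThan t L) where

    smallDFVS-∷-sameClass : ∀ {k} (r : SmallDFVS L k) → label r u ≡ label r v →
                            SmallDFVS (((u , v) , t) ∷ L) k
    smallDFVS-∷-sameClass r gu≡gv = record
      { label = label r ; label-onto = label-onto r
      ; label-constant = λ { (here refl) → gu≡gv ; (there a∈) → label-constant r a∈ }
      ; S = S r ∪ ⁅ v ⁆
      ; S-small = ≤-trans (+-monoˡ-≤ n (∣p∪⁅x⁆∣≤1+∣p∣ (S r) v)) (s≤s (S-small r))
      ; S-isDFVS = isDFVS-transfer-∪⁅⁆ (closedChain-old-or-visits new-ends-at-v) (S-isDFVS r) }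
      where
      new-ends-at-v : ∀ {a b} → ReachIn (((u , v) , t) ∷ L) a b → ReachIn L a b ⊎ b ≡ v
      new-ends-at-v = map₂ proj₂ ∘ ReachIn-∷-latest L≤t (label-constant r)

    smallDFVS-∷-mergeClasses : ∀ {k} (r : SmallDFVS L (suc k)) → label r u ≢ label r v →
                               SmallDFVS (((u , v) , t) ∷ L) k
    smallDFVS-∷-mergeClasses {k} r gu≢gv = record
      { label = merge ∘ label r
      ; label-onto = λ c → let (d , merge-d) = collapse-onto gu≢gv c ; (x , gx) = label-onto r d
                           in x , trans (cong merge gx) merge-d
      ; label-constant = λ { (here refl) → collapse-identifies gu≢gv
                           ; (there a∈)  → cong merge (label-constant r a∈) }
      ; S = S r ; S-small = ≤-trans (S-small r) (≤-reflexive (+-suc (length L) k))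
      ; S-isDFVS = isDFVS-transfer (closedChain-old InClassOf-v new-enters-class-of-v old-keeps-class)
                                   (S-isDFVS r) }
      where
      merge : Fin (suc k) → Fin k
      merge = collapse gu≢gv
      InClassOf-v : Fin n → Set
      InClassOf-v x = label r x ≡ label r v
      new-enters-class-of-v : ∀ {a b} → ReachIn (((u , v) , t) ∷ L) a b →
                              ReachIn L a b ⊎ (¬ InClassOf-v a × InClassOf-v b)
      new-enters-class-of-v ab with ReachIn-∷-latest L≤t (label-constant r) ab
      ... | inj₁ ab'            = inj₁ ab'
      ... | inj₂ (ga≡gu , refl) = inj₂ ((λ ga≡gv → gu≢gv (trans (sym ga≡gu) ga≡gv)) , refl)
      old-keeps-class : ∀ {a b} → ReachIn L a b → InClassOf-v a → InClassOf-v b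
      old-keeps-class (_ , _ , j) ga≡gv = trans (sym (JourneyIn-label (label-constant r) j)) ga≡gv

    smallDFVS-∷-latest : ∀ {k} → SmallDFVS L k → ∃[ k' ] SmallDFVS (((u , v) , t) ∷ L) k'
    smallDFVS-∷-latest {zero}  r = ⊥-elim (¬Fin0 (label r u))
    smallDFVS-∷-latest {suc k} r with label r u ≟ label r v
    ... | yes gu≡gv = suc k , smallDFVS-∷-sameClass r gu≡gv
    ... | no gu≢gv  = k , smallDFVS-∷-mergeClasses r gu≢gv

  smallDFVS : ∀ L → ∃[ k ] SmallDFVS L k
  smallDFVS = latest-arc-induction (λ L → ∃[ k ] SmallDFVS L k)
    (λ p (k , r) → k , smallDFVS-↭ p r)
    (n , smallDFVS-[])
    (λ { {(_ , _) , _} L≤t (_ , r) → smallDFVS-∷-latest L≤t r })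

lemma3p4 : ∀ (n : ℕ) (G : TemporalDigraph n) (cc : ℕ) → HasComponents G cc →
    ∃[ S ] ((∣ S ∣ + n ≤ numArcs G + cc) × IsDFVS (Reach G) S)
lemma3p4 n G cc (component , _ , component≡⇔Connected) =
  S , ≤-trans S-small (+-monoʳ-≤ (numArcs G) k≤cc) , isDFVS-transfer (λ vs → Chain-map Reach⇒ReachIn vs) S-isDFVS
  where
  k : ℕ
  k = proj₁ (smallDFVS (arcs G))
  open SmallDFVS (proj₂ (smallDFVS (arcs G)))
  k≤cc : k ≤ cc
  k≤cc = surjective-coarsening⇒≤ component label label-onto
    (λ x y same → Connected-label {G = G} label-constant (Equivalence.to (component≡⇔Connected x y) same))
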